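{- Let $p,q$ be distinct primes, let $G$ be a group of order $8pq$ with a normal subgroup $\mathbb{Z}_{pq}$ of order $pq$, let $\overline{G} = G/\mathbb{Z}_{pq}$ (a group of order $8$), and let $S$ be an irredundant generating set of $G$. Then $d(\overline{G}) \le |S| \le d(\overline{G}) + 2$.
   Context: A generating set is irredundant if no proper subset of it generates the group. For a group $\overline{G}$ of prime-power order, $d(\overline{G})$ denotes the cardinality of any irredundant generating set of $\overline{G}$ (well defined by the Burnside Basis Theorem); e.g. $d(\mathbb{Z}_8)=1$, $d(\mathbb{Z}_4\times\mathbb{Z}_2)=d(D_8)=d(Q_8)=2$, $d((\mathbb{Z}_2)^3)=3$. -}

module Defs where

open import Data.Nat using (ℕ; zero; suc; _*_)
open import Data.Fin using (Fin)
open import Data.Fin.Subset using (Subset; _∈_; _⊆_; _⊂_; ∣_∣)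
open import Data.Product using (Σ; ∃; ∃-syntax; _×_; _,_)
open import Relation.Binary.PropositionalEquality using (_≡_)
open import Relation.Nullary using (¬_)
open import Function.Bundles using (_⇔_)
open import Algebra.Structures using (IsGroup)

-- A finite group of order n, with carrier Fin n (every group of order n is
-- isomorphic to one of these).
record FinGroup (n : ℕ) : Set where
  field
    _∙_ : Fin n → Fin n → Fin n
    ε : Fin n
    _⁻¹ : Fin n → Fin n
    isGroup : IsGroup _≡_ _∙_ ε _⁻¹

  _^_ : Fin n → ℕ → Fin n
  g ^ zero = ε
  g ^ suc k = g ∙ (g ^ k)

module _ {n : ℕ} (G : FinGroup n) where
  open FinGroup G

  IsSubgroup : Subset n → Set
  IsSubgroup H = (ε ∈ H)
    × (∀ x y → x ∈ H → y ∈ H → (x ∙ y) ∈ H)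
    × (∀ x → x ∈ H → (x ⁻¹) ∈ H)

  IsNormalSubgroup : Subset n → Set
  IsNormalSubgroup N = IsSubgroup N
    × (∀ g x → x ∈ N → ((g ∙ x) ∙ (g ⁻¹)) ∈ N)

  IsCyclicSubset : Subset n → Set
  IsCyclicSubset N = ∃[ g ] (g ∈ N × (∀ x → x ∈ N → ∃[ k ] x ≡ g ^ k))

  Generates : Subset n → Set
  Generates S = ∀ H → IsSubgroup H → S ⊆ H → ∀ x → x ∈ H

  IrredundantGenSet : Subset n → Set
  IrredundantGenSet S = Generates S × (∀ T → T ⊂ S → ¬ Generates T)

-- π : G → Ḡ is a surjective homomorphism with kernel exactly N,
-- i.e. Ḡ ≅ G / N (first isomorphism theorem).
record IsQuotientBy {n m : ℕ} (G : FinGroup n) (N : Subset n) (Ḡ : FinGroup m) : Set where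
  private
    module G = FinGroup G
    module Ḡ = FinGroup Ḡ
  field
    π : Fin n → Fin m
    hom : ∀ x y → π (x G.∙ y) ≡ π x Ḡ.∙ π y
    surj : ∀ y → ∃[ x ] π x ≡ y
    kernel : ∀ x → (π x ≡ Ḡ.ε) ⇔ (x ∈ N)

module Submission where

-- Removing the elements of an irredundant generating set Y one at a time gives a strict chain of
-- subgroups, each of index at least 2 in the next, so 2 ^ ∣ Y ∣ ≤ ∣ G ∣. In a group of order 8
-- this gives ∣ Y ∣ ≤ 3. If ∣ Y ∣ = 3 the chain forces the generators to be commuting involutions,
-- so the group is elementary abelian and no two elements generate it; if one element generates,
-- the group is cyclic and no irredundant generating set has two elements. Hence all irredundant
-- generating sets of Ḡ have the same size, and it is at most ∣ π S ∣ ≤ ∣ S ∣.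
-- For the upper bound, lift an irredundant generating set contained in π S to some R ⊆ S of at
-- most its size. Three elements a, b, c of S outside R would give subgroups
-- ⟪ S - a - b - c ⟫ ⊂ ⟪ S - a - b ⟫ ⊂ ⟪ S - a ⟫ ⊂ G that all map onto Ḡ, so their intersections
-- with N = ker π strictly increase; their orders would be a chain of three proper divisors ending
-- in p * q, which has only two prime factors.

open import Defs
import Data.Nat as ℕ
open import Data.Nat using (ℕ; zero; suc; _*_; _+_; _∸_; _≤_; _<_; z≤n; s≤s; s≤s⁻¹; _≤?_; NonZero; >-nonZero)
open import Data.Nat.DivMod using (_%_; _/_; m≡m%n+[m/n]*n; m%n<n)
open import Data.Nat.Properties
open import Data.Nat.Divisibility using (_∣_; divides; ∣-refl; ∣m∣n⇒∣m+n)
open import Data.Nat.Primality using (Prime; euclidsLemma; prime⇒irreducible; prime⇒nonZero)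
open import Data.Bool using (true; false)
open import Data.Fin using (Fin; zero; suc; toℕ; fromℕ<)
import Data.Fin.Properties as Finₚ
open Finₚ using (all?; any?)
open import Data.Fin.Subset
open import Data.Fin.Subset.Properties
open import Data.Vec using (_∷_; []; here; there; tabulate)
open import Data.Vec.Properties using ([]=⇒lookup; lookup⇒[]=; lookup∘tabulate)
open import Data.Product using (∃; ∃-syntax; _×_; _,_; proj₁; proj₂)
open import Data.Sum using (_⊎_; inj₁; inj₂; [_,_]′; fromInj₂)
open import Function using (_∘_; case_of_)
open import Relation.Binary.PropositionalEquality
open import Relation.Nullary using (¬_; Dec; yes; no; does; contradiction)
open import Relation.Nullary.Decidable using (map′; from-no; dec-true; decidable-stable; _×-dec_; _→-dec_; _⊎-dec_; ¬?)
open import Relation.Unary using (Pred; Decidable)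
open import Level using (0ℓ)
open import Induction.WellFounded using (module All)
open import Data.Fin.Subset.Induction using (⊂-wellFounded)
open import Algebra.Bundles using (Group; CommutativeSemigroup)
import Algebra.Properties.CommutativeSemigroup as CommutativeSemigroupProperties
open import Algebra.Structures using (IsGroup)
open import Function.Bundles using (Equivalence)
import Algebra.Properties.Group as GroupProperties

module _ {n : ℕ} where

  -- Opaque, so that the typechecker does not unfold the subset searches behind ⟪_⟫ when
  -- comparing subsets of a concrete group.
  opaque
    select : {P : Pred (Fin n) 0ℓ} → Decidable P → Subset n
    select P? = tabulate (does ∘ P?)

    ∈-select⁺ : {P : Pred (Fin n) 0ℓ} (P? : Decidable P) {x : Fin n} → P x → x ∈ select P?
    ∈-select⁺ P? {x} px = lookup⇒[]= x _ (trans (lookup∘tabulate _ x) (dec-true (P? x) px))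

    ∈-select⁻ : {P : Pred (Fin n) 0ℓ} (P? : Decidable P) {x : Fin n} → x ∈ select P? → P x
    ∈-select⁻ P? {x} x∈ with P? x | trans (sym (lookup∘tabulate (does ∘ P?) x)) ([]=⇒lookup x∈)
    ... | yes px | _ = px
    ... | no _   | ()

injection⇒∣p∣≤∣q∣ : ∀ {a b} {p : Subset a} {q : Subset b} (f : Fin a → Fin b) →
  (∀ {x} → x ∈ p → f x ∈ q) → (∀ {x y} → x ∈ p → y ∈ p → f x ≡ f y → x ≡ y) → ∣ p ∣ ≤ ∣ q ∣
injection⇒∣p∣≤∣q∣ {p = []} f into inj = z≤n
injection⇒∣p∣≤∣q∣ {p = false ∷ p} f into inj =
  injection⇒∣p∣≤∣q∣ (f ∘ suc) (into ∘ there) (λ x∈ y∈ → Finₚ.suc-injective ∘ inj (there x∈) (there y∈))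
injection⇒∣p∣≤∣q∣ {p = true ∷ p} {q} f into inj = begin
  suc ∣ p ∣         ≤⟨ s≤s (injection⇒∣p∣≤∣q∣ (f ∘ suc) into′ inj′) ⟩
  suc ∣ q - f zero ∣ ≤⟨ x∈p⇒∣p-x∣<∣p∣ (into here) ⟩
  ∣ q ∣              ∎
  where
  open ≤-Reasoning
  inj′ : ∀ {x y} → x ∈ p → y ∈ p → f (suc x) ≡ f (suc y) → x ≡ y
  inj′ x∈ y∈ = Finₚ.suc-injective ∘ inj (there x∈) (there y∈)
  into′ : ∀ {x} → x ∈ p → f (suc x) ∈ q - f zero
  into′ x∈ = x∈p∧x≢y⇒x∈p-y (into (there x∈)) (Finₚ.0≢1+n ∘ inj here (there x∈) ∘ sym)

x∈p─q⇒x∉q : ∀ {n} {p q : Subset n} {x : Fin n} → x ∈ p ─ q → x ∉ q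
x∈p─q⇒x∉q {p = s ∷ p} {true ∷ q} (there x∈) (there x∈q) = x∈p─q⇒x∉q x∈ x∈q
x∈p─q⇒x∉q {p = s ∷ p} {false ∷ q} (there x∈) (there x∈q) = x∈p─q⇒x∉q x∈ x∈q

x∈p-y⇒x≢y : ∀ {n} {p : Subset n} {x y : Fin n} → x ∈ p - y → x ≢ y
x∈p-y⇒x≢y x∈ refl = x∈p─q⇒x∉q x∈ (x∈⁅x⁆ _)

p-x⊆p : ∀ {n} {p : Subset n} {x : Fin n} → p - x ⊆ p
p-x⊆p {p = p} {x} = p─q⊆p p ⁅ x ⁆

∣p∣≡∣p∩q∣+∣p─q∣ : ∀ {n} (p q : Subset n) → ∣ p ∣ ≡ ∣ p ∩ q ∣ + ∣ p ─ q ∣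
∣p∣≡∣p∩q∣+∣p─q∣ [] [] = refl
∣p∣≡∣p∩q∣+∣p─q∣ (true ∷ p) (true ∷ q) = cong suc (∣p∣≡∣p∩q∣+∣p─q∣ p q)
∣p∣≡∣p∩q∣+∣p─q∣ (true ∷ p) (false ∷ q) =
  trans (cong suc (∣p∣≡∣p∩q∣+∣p─q∣ p q)) (sym (+-suc _ _))
∣p∣≡∣p∩q∣+∣p─q∣ (false ∷ p) (true ∷ q) = ∣p∣≡∣p∩q∣+∣p─q∣ p q
∣p∣≡∣p∩q∣+∣p─q∣ (false ∷ p) (false ∷ q) = ∣p∣≡∣p∩q∣+∣p─q∣ p q

x∈p⇒∣p∣≡1+∣p-x∣ : ∀ {n} {p : Subset n} {x : Fin n} → x ∈ p → ∣ p ∣ ≡ suc ∣ p - x ∣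
x∈p⇒∣p∣≡1+∣p-x∣ {p = true ∷ p} here = cong (suc ∘ ∣_∣) (sym (p─⊥≡p p))
x∈p⇒∣p∣≡1+∣p-x∣ {p = true ∷ p} (there x∈) = cong suc (x∈p⇒∣p∣≡1+∣p-x∣ x∈)
x∈p⇒∣p∣≡1+∣p-x∣ {p = false ∷ p} (there x∈) = x∈p⇒∣p∣≡1+∣p-x∣ x∈

Empty⇒∣p∣≡0 : ∀ {n} {p : Subset n} → Empty p → ∣ p ∣ ≡ 0
Empty⇒∣p∣≡0 {n} ∄x = trans (cong ∣_∣ (Empty-unique ∄x)) (∣⊥∣≡0 n)

p⊆q⇒p-x⊆q-x : ∀ {n} {p q : Subset n} {x : Fin n} → p ⊆ q → p - x ⊆ q - x
p⊆q⇒p-x⊆q-x p⊆q y∈ = x∈p∧x≢y⇒x∈p-y (p⊆q (p-x⊆p y∈)) (x∈p-y⇒x≢y y∈)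

0<∣p∣⇒nonempty : ∀ {n} {p : Subset n} → 0 < ∣ p ∣ → Nonempty p
0<∣p∣⇒nonempty {p = p} 0<∣p∣ with nonempty? p
... | yes ∃x = ∃x
... | no ∄x = contradiction (sym (Empty⇒∣p∣≡0 ∄x)) (<⇒≢ 0<∣p∣)

p⊈q⇒∃∉ : ∀ {n} {p q : Subset n} → ¬ p ⊆ q → ∃[ x ] x ∈ p × x ∉ q
p⊈q⇒∃∉ {p = p} {q} p⊈q with any? (λ x → (x ∈? p) ×-dec ¬? (x ∈? q))
... | yes ∃x = ∃x
... | no ∄x = contradiction (λ {x} x∈p → decidable-stable (x ∈? q) (λ x∉q → ∄x (x , x∈p , x∉q))) p⊈q

x∈p⇒0<∣p∣ : ∀ {n} {p : Subset n} {x : Fin n} → x ∈ p → 0 < ∣ p ∣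
x∈p⇒0<∣p∣ x∈ = ≤-<-trans z≤n (x∈p⇒∣p-x∣<∣p∣ x∈)

pick : ∀ {n} {p : Subset n} (k : ℕ) → suc k ≤ ∣ p ∣ → ∃[ x ] x ∈ p × k ≤ ∣ p - x ∣
pick k k<∣p∣ =
  let (x , x∈p) = 0<∣p∣⇒nonempty (≤-trans (s≤s z≤n) k<∣p∣)
  in x , x∈p , s≤s⁻¹ (≤-trans k<∣p∣ (≤-reflexive (x∈p⇒∣p∣≡1+∣p-x∣ x∈p)))

∣p∣≤2⇒y≡z : ∀ {n} {p : Subset n} {x y z : Fin n} → ∣ p ∣ ≤ 2 → x ∈ p → y ∈ p → z ∈ p →
         y ≢ x → z ≢ x → y ≡ z
∣p∣≤2⇒y≡z {p = p} {x} {y} {z} ∣p∣≤2 x∈ y∈ z∈ y≢x z≢x with y Finₚ.≟ z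
... | yes y≡z = y≡z
... | no y≢z = contradiction ∣p∣≤2 (<⇒≱ (begin-strict
  2                  ≤⟨ s≤s (x∈p⇒0<∣p∣ z∈p-x-y) ⟩
  suc ∣ p - x - y ∣   ≡⟨ x∈p⇒∣p∣≡1+∣p-x∣ y∈p-x ⟨
  ∣ p - x ∣           <⟨ x∈p⇒∣p-x∣<∣p∣ x∈ ⟩
  ∣ p ∣               ∎))
  where
  open ≤-Reasoning
  y∈p-x = x∈p∧x≢y⇒x∈p-y y∈ y≢x
  z∈p-x-y = x∈p∧x≢y⇒x∈p-y (x∈p∧x≢y⇒x∈p-y z∈ z≢x) (y≢z ∘ sym)

p⊆q⇒∣q∩p∣≡∣p∣ : ∀ {n} {p q : Subset n} → p ⊆ q → ∣ q ∩ p ∣ ≡ ∣ p ∣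
p⊆q⇒∣q∩p∣≡∣p∣ {p = p} {q} p⊆q =
  ≤-antisym (∣p∩q∣≤∣q∣ q p) (p⊆q⇒∣p∣≤∣q∣ (λ x∈p → x∈p∩q⁺ (p⊆q x∈p , x∈p)))

full⇒∣p∣≡n : ∀ {n} {p : Subset n} → (∀ x → x ∈ p) → ∣ p ∣ ≡ n
full⇒∣p∣≡n {n} {p} full = ≤-antisym (∣p∣≤n p)
  (≤-trans (≤-reflexive (sym (∣⊤∣≡n n)))
           (injection⇒∣p∣≤∣q∣ {p = ⊤} (λ x → x) (λ {x} _ → full x) (λ _ _ x≡y → x≡y)))

∣p∣≤1⇒p⊆⁅x⁆ : ∀ {n} {p : Subset n} {x : Fin n} → ∣ p ∣ ≤ 1 → x ∈ p → p ⊆ ⁅ x ⁆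
∣p∣≤1⇒p⊆⁅x⁆ {p = p} {x} ∣p∣≤1 x∈p {y} y∈p with y Finₚ.≟ x
... | yes refl = x∈⁅x⁆ y
... | no y≢x = contradiction ∣p∣≤1 (<⇒≱ (begin-strict
  1                <⟨ s≤s (x∈p⇒0<∣p∣ (x∈p∧x≢y⇒x∈p-y y∈p y≢x)) ⟩
  suc ∣ p - x ∣    ≡⟨ x∈p⇒∣p∣≡1+∣p-x∣ x∈p ⟨
  ∣ p ∣            ∎))
  where open ≤-Reasoning

⊂-rec : ∀ {n} {P : Subset n → Set} → (∀ p → (∀ {q} → q ⊂ p → P q) → P p) → ∀ p → P p
⊂-rec {P = P} = All.wfRec ⊂-wellFounded 0ℓ P

image : ∀ {a b} → (Fin a → Fin b) → Subset a → Subset b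
image f p = select (λ y → any? (λ x → (x ∈? p) ×-dec (y Finₚ.≟ f x)))

module _ {a b} (f : Fin a → Fin b) {p : Subset a} where

  ∈-image⁺ : ∀ {x} → x ∈ p → f x ∈ image f p
  ∈-image⁺ {x} x∈p = ∈-select⁺ (λ y → any? (λ x → (x ∈? p) ×-dec (y Finₚ.≟ f x))) (x , x∈p , refl)

  ∈-image⁻ : ∀ {y} → y ∈ image f p → ∃[ x ] x ∈ p × y ≡ f x
  ∈-image⁻ = ∈-select⁻ (λ y → any? (λ x → (x ∈? p) ×-dec (y Finₚ.≟ f x)))

private
  module Section {a b} (f : Fin (suc a) → Fin b) (p : Subset (suc a)) where

    section : Fin b → Fin (suc a)
    section y with any? (λ x → (x ∈? p) ×-dec (y Finₚ.≟ f x))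
    ... | yes (x , _) = x
    ... | no _ = zero

    section-∈ : ∀ {y} → y ∈ image f p → section y ∈ p × y ≡ f (section y)
    section-∈ {y} y∈ with any? (λ x → (x ∈? p) ×-dec (y Finₚ.≟ f x))
    ... | yes (x , x∈p , y≡fx) = x∈p , y≡fx
    ... | no ∄x = contradiction (∈-image⁻ f y∈) ∄x

∣image∣≤∣p∣ : ∀ {a b} (f : Fin a → Fin b) (p : Subset a) → ∣ image f p ∣ ≤ ∣ p ∣
∣image∣≤∣p∣ {zero} f [] = ≤-reflexive (Empty⇒∣p∣≡0 (λ { (y , y∈) → Finₚ.¬Fin0 (proj₁ (∈-image⁻ f y∈)) }))
∣image∣≤∣p∣ {suc a} f p = injection⇒∣p∣≤∣q∣ section (proj₁ ∘ section-∈) λ y∈ z∈ eq →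
  trans (proj₂ (section-∈ y∈)) (trans (cong f eq) (sym (proj₂ (section-∈ z∈))))
  where open Section f p

⊆image⇒∃small-preimage : ∀ {a b} (f : Fin a → Fin b) {p : Subset a} {q : Subset b} → q ⊆ image f p →
  ∃[ r ] r ⊆ p × ∣ r ∣ ≤ ∣ q ∣ × q ⊆ image f r
⊆image⇒∃small-preimage {zero} f {[]} q⊆ = [] , (λ ()) , z≤n , q⊆
⊆image⇒∃small-preimage {suc a} f {p} {q} q⊆ = image section q
  , (λ x∈ → let (y , y∈q , x≡) = ∈-image⁻ section x∈ in subst (_∈ p) (sym x≡) (proj₁ (section-∈ (q⊆ y∈q))))
  , ∣image∣≤∣p∣ section q
  , (λ y∈q → subst (_∈ image f (image section q)) (sym (proj₂ (section-∈ (q⊆ y∈q))))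
                    (∈-image⁺ f (∈-image⁺ section y∈q)))
  where open Section f p

infix 4 _⊏_
_⊏_ : ℕ → ℕ → Set
m ⊏ n = m ∣ n × m < n

⊏⇒2*≤ : ∀ {m n} → m ⊏ n → 2 * m ≤ n
⊏⇒2*≤ (divides zero refl , ())
⊏⇒2*≤ {m} (divides 1 refl , m<m+0) = contradiction (sym (+-identityʳ m)) (<⇒≢ m<m+0)
⊏⇒2*≤ {m} (divides (suc (suc c)) refl , _) = +-monoʳ-≤ m (+-monoʳ-≤ m z≤n)

⊏p*q⇒≡1⊎Prime : ∀ {p q d} → Prime p → Prime q → d ⊏ p * q → d ≡ 1 ⊎ Prime d
⊏p*q⇒≡1⊎Prime {p} {q} {d} p-prime q-prime (divides k p*q≡k*d , d<p*q)
  with euclidsLemma k d p-prime (divides q (trans (sym p*q≡k*d) (*-comm p q)))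
... | inj₂ (divides j d≡j*p) with prime⇒irreducible q-prime (divides k q≡k*j)
  where
  instance _ = prime⇒nonZero p-prime
  q≡k*j : q ≡ k * j
  q≡k*j = *-cancelʳ-≡ q (k * j) p (begin
    q * p         ≡⟨ *-comm q p ⟩
    p * q         ≡⟨ p*q≡k*d ⟩
    k * d         ≡⟨ cong (k *_) d≡j*p ⟩
    k * (j * p)   ≡⟨ *-assoc k j p ⟨
    k * j * p     ∎)
    where open ≡-Reasoning
...   | inj₁ refl = inj₂ (subst Prime (sym (trans d≡j*p (+-identityʳ p))) p-prime)
...   | inj₂ refl = contradiction (trans d≡j*p (*-comm q p)) (<⇒≢ d<p*q)
⊏p*q⇒≡1⊎Prime {p} {q} {d} p-prime q-prime (divides k p*q≡k*d , d<p*q)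
    | inj₁ (divides j k≡j*p) with prime⇒irreducible q-prime (divides j q≡j*d)
  where
  instance _ = prime⇒nonZero p-prime
  q≡j*d : q ≡ j * d
  q≡j*d = *-cancelʳ-≡ q (j * d) p (begin
    q * p         ≡⟨ *-comm q p ⟩
    p * q         ≡⟨ p*q≡k*d ⟩
    k * d         ≡⟨ cong (_* d) k≡j*p ⟩
    j * p * d     ≡⟨ *-assoc j p d ⟩
    j * (p * d)   ≡⟨ cong (j *_) (*-comm p d) ⟩
    j * (d * p)   ≡⟨ *-assoc j d p ⟨
    j * d * p     ∎)
    where open ≡-Reasoning
...   | inj₁ d≡1 = inj₁ d≡1
...   | inj₂ refl = inj₂ q-prime

no-⊏-chain-of-length-3-to-p*q : ∀ {p q a b c} → Prime p → Prime q →
  0 < a → a ⊏ b → b ⊏ c → ¬ c ⊏ p * q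
no-⊏-chain-of-length-3-to-p*q p-prime q-prime 0<a (_ , a<b) (b∣c , b<c) c⊏p*q
  with ⊏p*q⇒≡1⊎Prime p-prime q-prime c⊏p*q
... | inj₁ refl = <⇒≱ b<c (≤-trans 0<a (<⇒≤ a<b))
... | inj₂ c-prime with prime⇒irreducible c-prime b∣c
...   | inj₁ refl = <⇒≱ a<b 0<a
...   | inj₂ refl = <-irrefl refl b<c

module FinGroupTheory {n : ℕ} (G : FinGroup n) where

  open FinGroup G
  open IsGroup isGroup public using (isSemigroup; assoc; identityˡ; identityʳ; inverseˡ; inverseʳ)

  group : Group 0ℓ 0ℓ
  group = record { isGroup = isGroup }

  open GroupProperties group public
    using (∙-cancelˡ; identityˡ-unique; inverseˡ-unique; ⁻¹-anti-homo-∙; ε⁻¹≈ε;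
           \\-leftDividesˡ; \\-leftDividesʳ; //-rightDividesʳ)

  module _ {H : Subset n} (H≤G : IsSubgroup G H) where

    ε∈ : ε ∈ H
    ε∈ = proj₁ H≤G

    ∙-closed : ∀ {x y} → x ∈ H → y ∈ H → x ∙ y ∈ H
    ∙-closed = proj₁ (proj₂ H≤G) _ _

    ⁻¹-closed : ∀ {x} → x ∈ H → x ⁻¹ ∈ H
    ⁻¹-closed = proj₂ (proj₂ H≤G) _

  isSubgroup? : (H : Subset n) → Dec (IsSubgroup G H)
  isSubgroup? H = (ε ∈? H)
    ×-dec all? (λ x → all? (λ y → (x ∈? H) →-dec ((y ∈? H) →-dec (x ∙ y ∈? H))))
    ×-dec all? (λ x → (x ∈? H) →-dec (x ⁻¹ ∈? H))

  ⁅ε⁆-isSubgroup : IsSubgroup G ⁅ ε ⁆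
  ⁅ε⁆-isSubgroup = x∈⁅x⁆ ε
    , (λ x y x∈ y∈ → subst (_∈ ⁅ ε ⁆)
         (sym (trans (cong₂ _∙_ (x∈⁅y⁆⇒x≡y ε x∈) (x∈⁅y⁆⇒x≡y ε y∈)) (identityˡ ε))) (x∈⁅x⁆ ε))
    , (λ x x∈ → subst (_∈ ⁅ ε ⁆) (sym (trans (cong _⁻¹ (x∈⁅y⁆⇒x≡y ε x∈)) ε⁻¹≈ε)) (x∈⁅x⁆ ε))

  ∩-isSubgroup : ∀ {H K} → IsSubgroup G H → IsSubgroup G K → IsSubgroup G (H ∩ K)
  ∩-isSubgroup {H} {K} H≤G K≤G = x∈p∩q⁺ (ε∈ H≤G , ε∈ K≤G)
    , (λ x y x∈ y∈ → let (x∈H , x∈K) = x∈p∩q⁻ H K x∈ ; (y∈H , y∈K) = x∈p∩q⁻ H K y∈ in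
         x∈p∩q⁺ (∙-closed H≤G x∈H y∈H , ∙-closed K≤G x∈K y∈K))
    , (λ x x∈ → let (x∈H , x∈K) = x∈p∩q⁻ H K x∈ in x∈p∩q⁺ (⁻¹-closed H≤G x∈H , ⁻¹-closed K≤G x∈K))

  leftCoset : Fin n → Subset n → Subset n
  leftCoset x H = select (λ y → (x ⁻¹) ∙ y ∈? H)

  ∣leftCoset∣≡∣H∣ : ∀ x H → ∣ leftCoset x H ∣ ≡ ∣ H ∣
  ∣leftCoset∣≡∣H∣ x H = ≤-antisym
    (injection⇒∣p∣≤∣q∣ ((x ⁻¹) ∙_) (∈-select⁻ (λ y → (x ⁻¹) ∙ y ∈? H)) (λ _ _ → ∙-cancelˡ (x ⁻¹) _ _))
    (injection⇒∣p∣≤∣q∣ (x ∙_) (λ {h} h∈H → ∈-select⁺ (λ y → (x ⁻¹) ∙ y ∈? H)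
                                  (subst (_∈ H) (sym (\\-leftDividesʳ x h)) h∈H))
                             (λ _ _ → ∙-cancelˡ x _ _))

  IsUnionOfLeftCosets : Subset n → Subset n → Set
  IsUnionOfLeftCosets H U = ∀ {x h} → x ∈ U → h ∈ H → x ∙ h ∈ U

  ∣H∣-divides-union-of-cosets : ∀ {H} → IsSubgroup G H → ∀ U → IsUnionOfLeftCosets H U → ∣ H ∣ ∣ ∣ U ∣
  ∣H∣-divides-union-of-cosets {H} H≤G = ⊂-rec step
    where
    step : ∀ U → (∀ {V} → V ⊂ U → IsUnionOfLeftCosets H V → ∣ H ∣ ∣ ∣ V ∣) →
           IsUnionOfLeftCosets H U → ∣ H ∣ ∣ ∣ U ∣
    step U rec U-union with nonempty? U
    ... | no ∄x = subst (∣ H ∣ ∣_) (sym (Empty⇒∣p∣≡0 ∄x)) (divides 0 refl)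
    ... | yes (x , x∈U) = subst (∣ H ∣ ∣_) (sym ∣U∣≡∣H∣+∣U─C∣) (∣m∣n⇒∣m+n ∣-refl (rec U─C⊂U U─C-union))
      where
      C = leftCoset x H
      x⁻¹∙_∈H? = λ y → (x ⁻¹) ∙ y ∈? H
      C⊆U : C ⊆ U
      C⊆U {y} y∈C = subst (_∈ U) (\\-leftDividesˡ x y) (U-union x∈U (∈-select⁻ x⁻¹∙_∈H? y∈C))
      U─C⊂U : U ─ C ⊂ U
      U─C⊂U = p∩q≢∅⇒p─q⊂p U C (x , x∈p∩q⁺ (x∈U , ∈-select⁺ x⁻¹∙_∈H? (subst (_∈ H) (sym (inverseˡ x)) (ε∈ H≤G))))
      ∣U∣≡∣H∣+∣U─C∣ : ∣ U ∣ ≡ ∣ H ∣ + ∣ U ─ C ∣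
      ∣U∣≡∣H∣+∣U─C∣ = trans (∣p∣≡∣p∩q∣+∣p─q∣ U C)
        (cong (_+ ∣ U ─ C ∣) (trans (p⊆q⇒∣q∩p∣≡∣p∣ C⊆U) (∣leftCoset∣≡∣H∣ x H)))
      U─C-union : IsUnionOfLeftCosets H (U ─ C)
      U─C-union {y} {h} y∈U─C h∈H = x∈p∧x∉q⇒x∈p─q (U-union (p─q⊆p U C y∈U─C) h∈H) λ y∙h∈C →
        x∈p─q⇒x∉q y∈U─C (∈-select⁺ x⁻¹∙_∈H? (subst (_∈ H) (x⁻¹∙[y∙h]∙h⁻¹≡x⁻¹∙y h)
          (∙-closed H≤G (∈-select⁻ x⁻¹∙_∈H? y∙h∈C) (⁻¹-closed H≤G h∈H))))
        where
        x⁻¹∙[y∙h]∙h⁻¹≡x⁻¹∙y : ∀ h → ((x ⁻¹) ∙ (y ∙ h)) ∙ (h ⁻¹) ≡ (x ⁻¹) ∙ y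
        x⁻¹∙[y∙h]∙h⁻¹≡x⁻¹∙y h = trans (cong (_∙ (h ⁻¹)) (sym (assoc (x ⁻¹) y h))) (//-rightDividesʳ h ((x ⁻¹) ∙ y))

  lagrange : ∀ {H K} → IsSubgroup G H → IsSubgroup G K → H ⊆ K → ∣ H ∣ ∣ ∣ K ∣
  lagrange H≤G K≤G H⊆K = ∣H∣-divides-union-of-cosets H≤G _ (λ x∈K h∈H → ∙-closed K≤G x∈K (H⊆K h∈H))

  ⊂-subgroup⇒∣H∣⊏∣K∣ : ∀ {H K} → IsSubgroup G H → IsSubgroup G K → H ⊂ K → ∣ H ∣ ⊏ ∣ K ∣
  ⊂-subgroup⇒∣H∣⊏∣K∣ H≤G K≤G H⊂K = lagrange H≤G K≤G (proj₁ H⊂K) , p⊂q⇒∣p∣<∣q∣ H⊂K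

  private
    InEverySubgroupContaining : Subset n → Fin n → Set
    InEverySubgroupContaining X x = ∀ H → IsSubgroup G H → X ⊆ H → x ∈ H

    inEverySubgroupContaining? : ∀ X → Decidable (InEverySubgroupContaining X)
    inEverySubgroupContaining? X x
      with anySubset? (λ H → isSubgroup? H ×-dec (X ⊆? H) ×-dec ¬? (x ∈? H))
    ... | yes (H , H≤G , X⊆H , x∉H) = no λ x∈ → x∉H (x∈ H H≤G X⊆H)
    ... | no ∄H = yes λ H H≤G X⊆H →
      decidable-stable (x ∈? H) (λ x∉H → ∄H (H , H≤G , X⊆H , x∉H))

  ⟪_⟫ : Subset n → Subset n
  ⟪ X ⟫ = select (inEverySubgroupContaining? X)

  ⟪⟫-least : ∀ {X H} → IsSubgroup G H → X ⊆ H → ⟪ X ⟫ ⊆ H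
  ⟪⟫-least {X} {H} H≤G X⊆H x∈ = ∈-select⁻ (inEverySubgroupContaining? X) x∈ H H≤G X⊆H

  X⊆⟪X⟫ : ∀ {X} → X ⊆ ⟪ X ⟫
  X⊆⟪X⟫ {X} x∈X = ∈-select⁺ (inEverySubgroupContaining? X) (λ _ _ X⊆H → X⊆H x∈X)

  ⟪⟫-isSubgroup : ∀ X → IsSubgroup G ⟪ X ⟫
  ⟪⟫-isSubgroup X = in⟪X⟫ (λ H≤G _ → ε∈ H≤G)
    , (λ x y x∈ y∈ → in⟪X⟫ λ H≤G X⊆H → ∙-closed H≤G (⟪⟫-least H≤G X⊆H x∈) (⟪⟫-least H≤G X⊆H y∈))
    , (λ x x∈ → in⟪X⟫ λ H≤G X⊆H → ⁻¹-closed H≤G (⟪⟫-least H≤G X⊆H x∈))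
    where
    in⟪X⟫ : ∀ {x} → (∀ {H} → IsSubgroup G H → X ⊆ H → x ∈ H) → x ∈ ⟪ X ⟫
    in⟪X⟫ x∈ = ∈-select⁺ (inEverySubgroupContaining? X) (λ _ → x∈)

  ⟪⟫-mono : ∀ {X Y} → X ⊆ Y → ⟪ X ⟫ ⊆ ⟪ Y ⟫
  ⟪⟫-mono {Y = Y} X⊆Y = ⟪⟫-least (⟪⟫-isSubgroup Y) (X⊆⟪X⟫ ∘ X⊆Y)

  generates⇒∈⟪⟫ : ∀ {X} → Generates G X → ∀ x → x ∈ ⟪ X ⟫
  generates⇒∈⟪⟫ {X} X-gen = X-gen ⟪ X ⟫ (⟪⟫-isSubgroup X) X⊆⟪X⟫

  ∈⟪⟫⇒generates : ∀ {X} → (∀ x → x ∈ ⟪ X ⟫) → Generates G X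
  ∈⟪⟫⇒generates ∈⟪X⟫ H H≤G X⊆H x = ⟪⟫-least H≤G X⊆H (∈⟪X⟫ x)

  generates? : ∀ X → Dec (Generates G X)
  generates? X = map′ ∈⟪⟫⇒generates generates⇒∈⟪⟫ (all? (_∈? ⟪ X ⟫))

  generates-⊆⟪⟫ : ∀ {X Y} → X ⊆ ⟪ Y ⟫ → Generates G X → Generates G Y
  generates-⊆⟪⟫ X⊆⟪Y⟫ X-gen H H≤G Y⊆H = X-gen H H≤G (⟪⟫-least H≤G Y⊆H ∘ X⊆⟪Y⟫)

  generates-mono : ∀ {X Y} → X ⊆ Y → Generates G X → Generates G Y
  generates-mono X⊆Y = generates-⊆⟪⟫ (X⊆⟪X⟫ ∘ X⊆Y)

  generates⇒∣⟪X⟫∣≡n : ∀ {X} → Generates G X → ∣ ⟪ X ⟫ ∣ ≡ n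
  generates⇒∣⟪X⟫∣≡n = full⇒∣p∣≡n ∘ generates⇒∈⟪⟫

  generates⇒nonempty : 1 < n → ∀ {X} → Generates G X → Nonempty X
  generates⇒nonempty 1<n {X} X-gen with nonempty? X
  ... | yes x∈X = x∈X
  ... | no ∄x = contradiction (full⇒∣p∣≡n (X-gen ⁅ ε ⁆ ⁅ε⁆-isSubgroup (λ x∈X → contradiction (_ , x∈X) ∄x)))
                              (λ ∣⁅ε⁆∣≡n → <⇒≢ 1<n (trans (sym (∣⁅x⁆∣≡1 ε)) ∣⁅ε⁆∣≡n))

  irredundant⇒∉⟪⟫ : ∀ {Y X y} → IrredundantGenSet G Y → y ∈ Y → X ⊆ Y - y → y ∉ ⟪ X ⟫
  irredundant⇒∉⟪⟫ {Y} {X} {y} (Y-gen , Y-min) y∈Y X⊆Y-y y∈⟪X⟫ =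
    Y-min (Y - y) (x∈p⇒p-x⊂p y∈Y) (∈⟪⟫⇒generates (Y-gen _ (⟪⟫-isSubgroup (Y - y)) Y⊆⟪Y-y⟫))
    where
    Y⊆⟪Y-y⟫ : Y ⊆ ⟪ Y - y ⟫
    Y⊆⟪Y-y⟫ {x} x∈Y with x Finₚ.≟ y
    ... | yes refl = ⟪⟫-mono X⊆Y-y y∈⟪X⟫
    ... | no x≢y = X⊆⟪X⟫ (x∈p∧x≢y⇒x∈p-y x∈Y x≢y)

  irredundant⇒∣⟪X-x⟫∣⊏∣⟪X⟫∣ : ∀ {Y X x} → IrredundantGenSet G Y → X ⊆ Y → x ∈ X →
                               ∣ ⟪ X - x ⟫ ∣ ⊏ ∣ ⟪ X ⟫ ∣
  irredundant⇒∣⟪X-x⟫∣⊏∣⟪X⟫∣ Y-irr X⊆Y x∈X = ⊂-subgroup⇒∣H∣⊏∣K∣ (⟪⟫-isSubgroup _) (⟪⟫-isSubgroup _)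
    (⟪⟫-mono p-x⊆p , _ , X⊆⟪X⟫ x∈X , irredundant⇒∉⟪⟫ Y-irr (X⊆Y x∈X) (p⊆q⇒p-x⊆q-x X⊆Y))

  irredundant⇒2^∣X∣≤∣⟪X⟫∣ : ∀ {Y} → IrredundantGenSet G Y → ∀ X → X ⊆ Y → 2 ℕ.^ ∣ X ∣ ≤ ∣ ⟪ X ⟫ ∣
  irredundant⇒2^∣X∣≤∣⟪X⟫∣ {Y} Y-irr = ⊂-rec step
    where
    step : ∀ X → (∀ {X′} → X′ ⊂ X → X′ ⊆ Y → 2 ℕ.^ ∣ X′ ∣ ≤ ∣ ⟪ X′ ⟫ ∣) →
           X ⊆ Y → 2 ℕ.^ ∣ X ∣ ≤ ∣ ⟪ X ⟫ ∣
    step X rec X⊆Y with nonempty? X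
    ... | no ∄x = subst (λ k → 2 ℕ.^ k ≤ ∣ ⟪ X ⟫ ∣) (sym (Empty⇒∣p∣≡0 ∄x)) (x∈p⇒0<∣p∣ (ε∈ (⟪⟫-isSubgroup X)))
    ... | yes (x , x∈X) = begin
      2 ℕ.^ ∣ X ∣          ≡⟨ cong (2 ℕ.^_) (x∈p⇒∣p∣≡1+∣p-x∣ x∈X) ⟩
      2 * 2 ℕ.^ ∣ X - x ∣  ≤⟨ *-monoʳ-≤ 2 (rec (x∈p⇒p-x⊂p x∈X) (X⊆Y ∘ p-x⊆p)) ⟩
      2 * ∣ ⟪ X - x ⟫ ∣     ≤⟨ ⊏⇒2*≤ (irredundant⇒∣⟪X-x⟫∣⊏∣⟪X⟫∣ Y-irr X⊆Y x∈X) ⟩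
      ∣ ⟪ X ⟫ ∣             ∎
      where open ≤-Reasoning

  irredundant⇒2^∣Y∣≤n : ∀ {Y} → IrredundantGenSet G Y → 2 ℕ.^ ∣ Y ∣ ≤ n
  irredundant⇒2^∣Y∣≤n Y-irr = ≤-trans (irredundant⇒2^∣X∣≤∣⟪X⟫∣ Y-irr _ (λ y∈Y → y∈Y))
                                      (≤-reflexive (generates⇒∣⟪X⟫∣≡n (proj₁ Y-irr)))

  generates⇒∃irredundant⊆ : ∀ X → Generates G X → ∃[ Y ] Y ⊆ X × IrredundantGenSet G Y
  generates⇒∃irredundant⊆ = ⊂-rec step
    where
    step : ∀ X → (∀ {X′} → X′ ⊂ X → Generates G X′ → ∃[ Y ] Y ⊆ X′ × IrredundantGenSet G Y) →
           Generates G X → ∃[ Y ] Y ⊆ X × IrredundantGenSet G Y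
    step X rec X-gen with any? (λ y → (y ∈? X) ×-dec generates? (X - y))
    ... | yes (y , y∈X , X-y-gen) with rec (x∈p⇒p-x⊂p y∈X) X-y-gen
    ...   | Y , Y⊆X-y , Y-irr = Y , p-x⊆p ∘ Y⊆X-y , Y-irr
    step X rec X-gen | no ∄y = X , (λ x∈X → x∈X) , X-gen , λ T (T⊆X , y , y∈X , y∉T) T-gen →
      ∄y (y , y∈X , generates-mono (λ t∈T → x∈p∧x≢y⇒x∈p-y (T⊆X t∈T) λ { refl → y∉T t∈T }) T-gen)

  ∣H∣≡2⇒x∙x≡ε : ∀ {H x} → IsSubgroup G H → ∣ H ∣ ≡ 2 → x ∈ H → x ∙ x ≡ ε
  ∣H∣≡2⇒x∙x≡ε {H} {x} H≤G ∣H∣≡2 x∈H with x Finₚ.≟ ε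
  ... | yes refl = identityˡ ε
  ... | no x≢ε = sym (∣p∣≤2⇒y≡z (≤-reflexive ∣H∣≡2) x∈H (ε∈ H≤G) (∙-closed H≤G x∈H x∈H)
                             (x≢ε ∘ sym) (x≢ε ∘ identityˡ-unique x x))

  ∣H─K∣≤2⇒commute : ∀ {H K x y} → IsSubgroup G H → IsSubgroup G K → K ⊆ H → ∣ H ─ K ∣ ≤ 2 →
                    x ∈ K → y ∈ H ─ K → x ∙ y ≡ y ∙ x
  ∣H─K∣≤2⇒commute {H} {K} {x} {y} H≤G K≤G K⊆H ∣H─K∣≤2 x∈K y∈H─K with x Finₚ.≟ ε
  ... | yes refl = trans (identityˡ y) (sym (identityʳ y))
  ... | no x≢ε = ∣p∣≤2⇒y≡z ∣H─K∣≤2 y∈H─K x∙y∈H─K y∙x∈H─K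
                  (x≢ε ∘ identityˡ-unique x y) (x≢ε ∘ sym ∘ ∙-cancelˡ y ε x ∘ trans (identityʳ y) ∘ sym)
    where
    y∈H = p─q⊆p H K y∈H─K
    y∉K = x∈p─q⇒x∉q y∈H─K
    x∙y∈H─K : x ∙ y ∈ H ─ K
    x∙y∈H─K = x∈p∧x∉q⇒x∈p─q (∙-closed H≤G (K⊆H x∈K) y∈H) λ xy∈K →
      y∉K (subst (_∈ K) (\\-leftDividesʳ x y) (∙-closed K≤G (⁻¹-closed K≤G x∈K) xy∈K))
    y∙x∈H─K : y ∙ x ∈ H ─ K
    y∙x∈H─K = x∈p∧x∉q⇒x∈p─q (∙-closed H≤G y∈H (K⊆H x∈K)) λ yx∈K →
      y∉K (subst (_∈ K) (//-rightDividesʳ x y) (∙-closed K≤G yx∈K (⁻¹-closed K≤G x∈K)))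

  centralizer : Fin n → Subset n
  centralizer x = select (λ z → (z ∙ x) Finₚ.≟ (x ∙ z))

  centralizer-isSubgroup : ∀ x → IsSubgroup G (centralizer x)
  centralizer-isSubgroup x = ∈C (trans (identityˡ x) (sym (identityʳ x)))
    , (λ y z y∈ z∈ → ∈C (begin
        (y ∙ z) ∙ x   ≡⟨ assoc y z x ⟩
        y ∙ (z ∙ x)   ≡⟨ cong (y ∙_) (C∋ z∈) ⟩
        y ∙ (x ∙ z)   ≡⟨ assoc y x z ⟨
        (y ∙ x) ∙ z   ≡⟨ cong (_∙ z) (C∋ y∈) ⟩
        (x ∙ y) ∙ z   ≡⟨ assoc x y z ⟩
        x ∙ (y ∙ z)   ∎))
    , (λ z z∈ → ∈C (begin
        (z ⁻¹) ∙ x                       ≡⟨ //-rightDividesʳ z ((z ⁻¹) ∙ x) ⟨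
        (((z ⁻¹) ∙ x) ∙ z) ∙ (z ⁻¹)      ≡⟨ cong (_∙ (z ⁻¹)) (assoc (z ⁻¹) x z) ⟩
        ((z ⁻¹) ∙ (x ∙ z)) ∙ (z ⁻¹)      ≡⟨ cong (λ w → ((z ⁻¹) ∙ w) ∙ (z ⁻¹)) (C∋ z∈) ⟨
        ((z ⁻¹) ∙ (z ∙ x)) ∙ (z ⁻¹)      ≡⟨ cong (_∙ (z ⁻¹)) (\\-leftDividesʳ z x) ⟩
        x ∙ (z ⁻¹)                       ∎))
    where
    open ≡-Reasoning
    ∈C : ∀ {z} → z ∙ x ≡ x ∙ z → z ∈ centralizer x
    ∈C = ∈-select⁺ (λ z → (z ∙ x) Finₚ.≟ (x ∙ z))
    C∋ : ∀ {z} → z ∈ centralizer x → z ∙ x ≡ x ∙ z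
    C∋ = ∈-select⁻ (λ z → (z ∙ x) Finₚ.≟ (x ∙ z))

  commuting-generators⇒commutative : ∀ {X} → Generates G X →
    (∀ {x y} → x ∈ X → y ∈ X → x ∙ y ≡ y ∙ x) → ∀ x y → x ∙ y ≡ y ∙ x
  commuting-generators⇒commutative {X} X-gen X-comm x y =
    central (λ z∈X → ∈C (sym (central (λ w∈X → ∈C (X-comm w∈X z∈X)) y))) x
    where
    ∈C : ∀ {z w} → z ∙ w ≡ w ∙ z → z ∈ centralizer w
    ∈C {w = w} = ∈-select⁺ (λ z → (z ∙ w) Finₚ.≟ (w ∙ z))
    central : ∀ {z} → X ⊆ centralizer z → ∀ w → w ∙ z ≡ z ∙ w
    central {z} X⊆C w = ∈-select⁻ (λ w → (w ∙ z) Finₚ.≟ (z ∙ w)) (X-gen _ (centralizer-isSubgroup z) X⊆C w)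

  module Commutative (comm : ∀ x y → x ∙ y ≡ y ∙ x) where

    commutativeSemigroup : CommutativeSemigroup 0ℓ 0ℓ
    commutativeSemigroup = record { isCommutativeSemigroup = record { isSemigroup = isSemigroup ; comm = comm } }

    open CommutativeSemigroupProperties commutativeSemigroup using (interchange; x∙yz≈y∙xz)

    squares-of-generators-trivial : ∀ {X} → Generates G X → (∀ {x} → x ∈ X → x ∙ x ≡ ε) →
                                    ∀ x → x ∙ x ≡ ε
    squares-of-generators-trivial {X} X-gen X-sq x =
      ∈-select⁻ x∙x≟ε (X-gen _ involutions-isSubgroup (∈-select⁺ x∙x≟ε ∘ X-sq) x)
      where
      x∙x≟ε = λ x → (x ∙ x) Finₚ.≟ ε
      involutions-isSubgroup : IsSubgroup G (select x∙x≟ε)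
      involutions-isSubgroup = ∈-select⁺ x∙x≟ε (identityˡ ε)
        , (λ x y x∈ y∈ → ∈-select⁺ x∙x≟ε (begin
            (x ∙ y) ∙ (x ∙ y)   ≡⟨ interchange x y x y ⟩
            (x ∙ x) ∙ (y ∙ y)   ≡⟨ cong₂ _∙_ (∈-select⁻ x∙x≟ε x∈) (∈-select⁻ x∙x≟ε y∈) ⟩
            ε ∙ ε               ≡⟨ identityˡ ε ⟩
            ε                   ∎))
        , (λ x x∈ → ∈-select⁺ x∙x≟ε (begin
            (x ⁻¹) ∙ (x ⁻¹)     ≡⟨ ⁻¹-anti-homo-∙ x x ⟨
            (x ∙ x) ⁻¹          ≡⟨ cong _⁻¹ (∈-select⁻ x∙x≟ε x∈) ⟩
            ε ⁻¹                ≡⟨ ε⁻¹≈ε ⟩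
            ε                   ∎))
        where open ≡-Reasoning

    module Exponent2 (x∙x≡ε : ∀ x → x ∙ x ≡ ε) where

      adjoin : Subset n → Fin n → Subset n
      adjoin K v = select (λ x → (x ∈? K) ⊎-dec ((v ∙ x) ∈? K))

      module _ {K : Subset n} (K≤G : IsSubgroup G K) (v : Fin n) where

        private
          K∪vK? = λ x → (x ∈? K) ⊎-dec ((v ∙ x) ∈? K)

        K⊆adjoin : K ⊆ adjoin K v
        K⊆adjoin = ∈-select⁺ K∪vK? ∘ inj₁

        v∈adjoin : v ∈ adjoin K v
        v∈adjoin = ∈-select⁺ K∪vK? (inj₂ (subst (_∈ K) (sym (x∙x≡ε v)) (ε∈ K≤G)))

        adjoin-isSubgroup : IsSubgroup G (adjoin K v)
        adjoin-isSubgroup = K⊆adjoin (ε∈ K≤G)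
          , (λ x y x∈ y∈ → ∈-select⁺ K∪vK? (∙-closed′ (∈-select⁻ K∪vK? x∈) (∈-select⁻ K∪vK? y∈)))
          , (λ x x∈ → subst (_∈ adjoin K v) (inverseˡ-unique x x (x∙x≡ε x)) x∈)
          where
          ∙-closed′ : ∀ {x y} → x ∈ K ⊎ (v ∙ x) ∈ K → y ∈ K ⊎ (v ∙ y) ∈ K →
                      (x ∙ y) ∈ K ⊎ (v ∙ (x ∙ y)) ∈ K
          ∙-closed′ (inj₁ x∈K) (inj₁ y∈K) = inj₁ (∙-closed K≤G x∈K y∈K)
          ∙-closed′ {x} {y} (inj₁ x∈K) (inj₂ vy∈K) =
            inj₂ (subst (_∈ K) (sym (x∙yz≈y∙xz v x y)) (∙-closed K≤G x∈K vy∈K))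
          ∙-closed′ {x} {y} (inj₂ vx∈K) (inj₁ y∈K) =
            inj₂ (subst (_∈ K) (assoc v x y) (∙-closed K≤G vx∈K y∈K))
          ∙-closed′ {x} {y} (inj₂ vx∈K) (inj₂ vy∈K) = inj₁ (subst (_∈ K) vx∙vy≡x∙y (∙-closed K≤G vx∈K vy∈K))
            where
            vx∙vy≡x∙y : (v ∙ x) ∙ (v ∙ y) ≡ x ∙ y
            vx∙vy≡x∙y = trans (interchange v x v y) (trans (cong (_∙ (x ∙ y)) (x∙x≡ε v)) (identityˡ (x ∙ y)))

        ∣adjoin∣≤2*∣K∣ : ∣ adjoin K v ∣ ≤ 2 * ∣ K ∣
        ∣adjoin∣≤2*∣K∣ = begin
          ∣ adjoin K v ∣                               ≡⟨ ∣p∣≡∣p∩q∣+∣p─q∣ (adjoin K v) K ⟩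
          ∣ adjoin K v ∩ K ∣ + ∣ adjoin K v ─ K ∣       ≤⟨ +-mono-≤ (∣p∩q∣≤∣q∣ (adjoin K v) K) ∣D─K∣≤∣K∣ ⟩
          ∣ K ∣ + ∣ K ∣                                 ≡⟨ cong (∣ K ∣ +_) (+-identityʳ ∣ K ∣) ⟨
          2 * ∣ K ∣                                     ∎
          where
          open ≤-Reasoning
          ∣D─K∣≤∣K∣ : ∣ adjoin K v ─ K ∣ ≤ ∣ K ∣
          ∣D─K∣≤∣K∣ = injection⇒∣p∣≤∣q∣ (v ∙_)
            (λ x∈ → fromInj₂ (λ x∈K → contradiction x∈K (x∈p─q⇒x∉q x∈))
                             (∈-select⁻ K∪vK? (p─q⊆p (adjoin K v) K x∈)))
            (λ _ _ → ∙-cancelˡ v _ _)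

      ∣⟪X⟫∣≤2^∣X∣ : ∀ X → ∣ ⟪ X ⟫ ∣ ≤ 2 ℕ.^ ∣ X ∣
      ∣⟪X⟫∣≤2^∣X∣ = ⊂-rec step
        where
        step : ∀ X → (∀ {X′} → X′ ⊂ X → ∣ ⟪ X′ ⟫ ∣ ≤ 2 ℕ.^ ∣ X′ ∣) → ∣ ⟪ X ⟫ ∣ ≤ 2 ℕ.^ ∣ X ∣
        step X rec with nonempty? X
        ... | no ∄x = begin
          ∣ ⟪ X ⟫ ∣         ≤⟨ p⊆q⇒∣p∣≤∣q∣ (⟪⟫-least ⁅ε⁆-isSubgroup (λ x∈X → contradiction (_ , x∈X) ∄x)) ⟩
          ∣ ⁅ ε ⁆ ∣         ≡⟨ ∣⁅x⁆∣≡1 ε ⟩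
          1                 ≡⟨ cong (2 ℕ.^_) (Empty⇒∣p∣≡0 ∄x) ⟨
          2 ℕ.^ ∣ X ∣       ∎
          where open ≤-Reasoning
        ... | yes (x , x∈X) = begin
          ∣ ⟪ X ⟫ ∣                        ≤⟨ p⊆q⇒∣p∣≤∣q∣ (⟪⟫-least (adjoin-isSubgroup H≤G x) X⊆adjoin) ⟩
          ∣ adjoin ⟪ X - x ⟫ x ∣           ≤⟨ ∣adjoin∣≤2*∣K∣ H≤G x ⟩
          2 * ∣ ⟪ X - x ⟫ ∣                ≤⟨ *-monoʳ-≤ 2 (rec (x∈p⇒p-x⊂p x∈X)) ⟩
          2 * 2 ℕ.^ ∣ X - x ∣              ≡⟨ cong (2 ℕ.^_) (x∈p⇒∣p∣≡1+∣p-x∣ x∈X) ⟨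
          2 ℕ.^ ∣ X ∣                      ∎
          where
          open ≤-Reasoning
          H≤G = ⟪⟫-isSubgroup (X - x)
          X⊆adjoin : X ⊆ adjoin ⟪ X - x ⟫ x
          X⊆adjoin {y} y∈X with y Finₚ.≟ x
          ... | yes refl = v∈adjoin H≤G y
          ... | no y≢x = K⊆adjoin H≤G x (X⊆⟪X⟫ (x∈p∧x≢y⇒x∈p-y y∈X y≢x))

  ^-+ : ∀ x a b → x ^ (a + b) ≡ (x ^ a) ∙ (x ^ b)
  ^-+ x zero b = sym (identityˡ (x ^ b))
  ^-+ x (suc a) b = trans (cong (x ∙_) (^-+ x a b)) (sym (assoc x (x ^ a) (x ^ b)))

  ε^k≡ε : ∀ k → ε ^ k ≡ ε
  ε^k≡ε zero = refl
  ε^k≡ε (suc k) = trans (identityˡ (ε ^ k)) (ε^k≡ε k)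

  ^-* : ∀ x a b → x ^ (a * b) ≡ (x ^ a) ^ b
  ^-* x a zero = cong (x ^_) (*-zeroʳ a)
  ^-* x a (suc b) = begin
    x ^ (a * suc b)         ≡⟨ cong (x ^_) (*-suc a b) ⟩
    x ^ (a + a * b)         ≡⟨ ^-+ x a (a * b) ⟩
    (x ^ a) ∙ (x ^ (a * b)) ≡⟨ cong ((x ^ a) ∙_) (^-* x a b) ⟩
    (x ^ a) ^ suc b         ∎
    where open ≡-Reasoning

  ^-closed : ∀ {H x} → IsSubgroup G H → x ∈ H → ∀ k → x ^ k ∈ H
  ^-closed H≤G x∈H zero = ε∈ H≤G
  ^-closed H≤G x∈H (suc k) = ∙-closed H≤G x∈H (^-closed H≤G x∈H k)

  module Powers (x : Fin n) (m : ℕ) .{{_ : NonZero m}} (x^m≡ε : x ^ m ≡ ε) where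

    x^k≡x^[k%m] : ∀ k → x ^ k ≡ x ^ (k % m)
    x^k≡x^[k%m] k = begin
      x ^ k                               ≡⟨ cong (x ^_) (m≡m%n+[m/n]*n k m) ⟩
      x ^ (k % m + k / m * m)             ≡⟨ ^-+ x (k % m) (k / m * m) ⟩
      (x ^ (k % m)) ∙ (x ^ (k / m * m))   ≡⟨ cong (λ j → (x ^ (k % m)) ∙ (x ^ j)) (*-comm (k / m) m) ⟩
      (x ^ (k % m)) ∙ (x ^ (m * (k / m))) ≡⟨ cong ((x ^ (k % m)) ∙_) (^-* x m (k / m)) ⟩
      (x ^ (k % m)) ∙ ((x ^ m) ^ (k / m)) ≡⟨ cong (λ y → (x ^ (k % m)) ∙ (y ^ (k / m))) x^m≡ε ⟩
      (x ^ (k % m)) ∙ (ε ^ (k / m))       ≡⟨ cong ((x ^ (k % m)) ∙_) (ε^k≡ε (k / m)) ⟩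
      (x ^ (k % m)) ∙ ε                   ≡⟨ identityʳ (x ^ (k % m)) ⟩
      x ^ (k % m)                         ∎
      where open ≡-Reasoning

    power : Fin m → Fin n
    power k = x ^ toℕ k

    powers : Subset n
    powers = image power ⊤

    x^k∈powers : ∀ k → x ^ k ∈ powers
    x^k∈powers k = subst (_∈ powers) (trans (cong (x ^_) (Finₚ.toℕ-fromℕ< (m%n<n k m))) (sym (x^k≡x^[k%m] k)))
                         (∈-image⁺ power {x = fromℕ< (m%n<n k m)} ∈⊤)

    powers-isSubgroup : IsSubgroup G powers
    powers-isSubgroup = x^k∈powers 0
      , (λ y z y∈ z∈ → let (i , _ , y≡) = ∈-image⁻ power y∈ ; (j , _ , z≡) = ∈-image⁻ power z∈ in
          subst (_∈ powers) (trans (^-+ x (toℕ i) (toℕ j)) (sym (cong₂ _∙_ y≡ z≡))) (x^k∈powers (toℕ i + toℕ j)))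
      , (λ y y∈ → let (i , _ , y≡) = ∈-image⁻ power y∈ in
          subst (_∈ powers) (trans (x^[m∸i]≡[x^i]⁻¹ (toℕ i) (<⇒≤ (Finₚ.toℕ<n i))) (cong _⁻¹ (sym y≡)))
                (x^k∈powers (m ∸ toℕ i)))
      where
      x^[m∸i]≡[x^i]⁻¹ : ∀ i → i ≤ m → x ^ (m ∸ i) ≡ (x ^ i) ⁻¹
      x^[m∸i]≡[x^i]⁻¹ i i≤m = inverseˡ-unique _ _
        (trans (sym (^-+ x (m ∸ i) i)) (trans (cong (x ^_) (m∸n+n≡m i≤m)) x^m≡ε))

    ⟪x⟫⊆powers : ⟪ ⁅ x ⁆ ⟫ ⊆ powers
    ⟪x⟫⊆powers = ⟪⟫-least powers-isSubgroup
      (λ y∈ → subst (_∈ powers) (trans (identityʳ x) (sym (x∈⁅y⁆⇒x≡y x y∈))) (x^k∈powers 1))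

    ∣⟪x⟫∣≤m : ∣ ⟪ ⁅ x ⁆ ⟫ ∣ ≤ m
    ∣⟪x⟫∣≤m = ≤-trans (p⊆q⇒∣p∣≤∣q∣ ⟪x⟫⊆powers) (≤-trans (∣image∣≤∣p∣ power ⊤) (≤-reflexive (∣⊤∣≡n m)))

  generator⇒g^n≡ε : ∀ {g} → Generates G ⁅ g ⁆ → g ^ n ≡ ε
  generator⇒g^n≡ε {g} g-gen with Finₚ.pigeonhole ≤-refl (λ (i : Fin (suc n)) → g ^ toℕ i)
  ... | i , j , i<j , g^i≡g^j = subst (λ k → g ^ k ≡ ε) d≡n g^d≡ε
    where
    d = toℕ j ∸ toℕ i
    g^d≡ε : g ^ d ≡ ε
    g^d≡ε = identityˡ-unique (g ^ d) (g ^ toℕ i)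
      (trans (sym (^-+ g d (toℕ i))) (trans (cong (g ^_) (m∸n+n≡m (<⇒≤ i<j))) (sym g^i≡g^j)))
    instance _ = >-nonZero (m<n⇒0<n∸m i<j)
    d≡n : d ≡ n
    d≡n = ≤-antisym (≤-trans (m∸n≤m (toℕ j) (toℕ i)) (s≤s⁻¹ (Finₚ.toℕ<n j)))
      (≤-trans (≤-reflexive (sym (generates⇒∣⟪X⟫∣≡n g-gen))) (Powers.∣⟪x⟫∣≤m g d g^d≡ε))

module Order8 (G : FinGroup 8) where

  open FinGroup G
  open FinGroupTheory G

  irredundant⇒∣Y∣≤3 : ∀ {Y} → IrredundantGenSet G Y → ∣ Y ∣ ≤ 3
  irredundant⇒∣Y∣≤3 {Y} Y-irr with ∣ Y ∣ ≤? 3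
  ... | yes ∣Y∣≤3 = ∣Y∣≤3
  ... | no ∣Y∣≰3 = contradiction (≤-trans (^-monoʳ-≤ 2 (≰⇒> ∣Y∣≰3)) (irredundant⇒2^∣Y∣≤n Y-irr))
                                 (from-no (16 ≤? 8))

  module _ {Y} (Y-irr : IrredundantGenSet G Y) (∣Y∣≡3 : ∣ Y ∣ ≡ 3) where

    -- With c the third element of Y, ⟪ Y - c - b ⟫ ⊂ ⟪ Y - c ⟫ ⊂ G have orders 2 and 4.
    x∙x≡ε×x∙y≡y∙x : ∀ {a b} → a ∈ Y → b ∈ Y → a ≢ b → a ∙ a ≡ ε × a ∙ b ≡ b ∙ a
    x∙x≡ε×x∙y≡y∙x {a} {b} a∈Y b∈Y a≢b =
      ∣H∣≡2⇒x∙x≡ε K≤G ∣K∣≡2 (X⊆⟪X⟫ a∈Y-c-b) ,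
      ∣H─K∣≤2⇒commute H≤G K≤G K⊆H ∣H─K∣≤2 (X⊆⟪X⟫ a∈Y-c-b)
        (x∈p∧x∉q⇒x∈p─q (X⊆⟪X⟫ b∈Y-c) (irredundant⇒∉⟪⟫ Y-irr b∈Y (p⊆q⇒p-x⊆q-x p-x⊆p)))
      where
      b∈Y-a : b ∈ Y - a
      b∈Y-a = x∈p∧x≢y⇒x∈p-y b∈Y (a≢b ∘ sym)
      ∣Y-a-b∣≡1 : ∣ Y - a - b ∣ ≡ 1
      ∣Y-a-b∣≡1 = suc-injective (suc-injective (trans (sym (trans (x∈p⇒∣p∣≡1+∣p-x∣ a∈Y)
                    (cong suc (x∈p⇒∣p∣≡1+∣p-x∣ b∈Y-a)))) ∣Y∣≡3))
      third : Nonempty (Y - a - b)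
      third = 0<∣p∣⇒nonempty (≤-reflexive (sym ∣Y-a-b∣≡1))
      c : Fin 8
      c = proj₁ third
      c∈Y-a-b : c ∈ Y - a - b
      c∈Y-a-b = proj₂ third
      c∈Y : c ∈ Y
      c∈Y = p-x⊆p (p-x⊆p c∈Y-a-b)
      b∈Y-c : b ∈ Y - c
      b∈Y-c = x∈p∧x≢y⇒x∈p-y b∈Y (x∈p-y⇒x≢y c∈Y-a-b ∘ sym)
      a∈Y-c-b : a ∈ Y - c - b
      a∈Y-c-b = x∈p∧x≢y⇒x∈p-y (x∈p∧x≢y⇒x∈p-y a∈Y (x∈p-y⇒x≢y (p-x⊆p c∈Y-a-b) ∘ sym)) a≢b
      H K : Subset 8
      H = ⟪ Y - c ⟫
      K = ⟪ Y - c - b ⟫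
      H≤G : IsSubgroup G H
      H≤G = ⟪⟫-isSubgroup (Y - c)
      K≤G : IsSubgroup G K
      K≤G = ⟪⟫-isSubgroup (Y - c - b)
      K⊆H : K ⊆ H
      K⊆H = ⟪⟫-mono p-x⊆p
      ∣H∣≤4 : ∣ H ∣ ≤ 4
      ∣H∣≤4 = *-cancelˡ-≤ 2 (⊏⇒2*≤ (subst (∣ H ∣ ⊏_) (generates⇒∣⟪X⟫∣≡n (proj₁ Y-irr))
                                     (irredundant⇒∣⟪X-x⟫∣⊏∣⟪X⟫∣ Y-irr (λ y∈ → y∈) c∈Y)))
      ∣K∣≡2 : ∣ K ∣ ≡ 2
      ∣K∣≡2 = ≤-antisym (*-cancelˡ-≤ 2 (≤-trans (⊏⇒2*≤ (irredundant⇒∣⟪X-x⟫∣⊏∣⟪X⟫∣ Y-irr p-x⊆p b∈Y-c)) ∣H∣≤4))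
        (≤-trans (*-monoʳ-≤ 2 (x∈p⇒0<∣p∣ (ε∈ (⟪⟫-isSubgroup (Y - c - b - a)))))
                 (⊏⇒2*≤ (irredundant⇒∣⟪X-x⟫∣⊏∣⟪X⟫∣ Y-irr (p-x⊆p ∘ p-x⊆p) a∈Y-c-b)))
      ∣H─K∣≤2 : ∣ H ─ K ∣ ≤ 2
      ∣H─K∣≤2 = +-cancelˡ-≤ 2 ∣ H ─ K ∣ 2 (begin
        2 + ∣ H ─ K ∣          ≡⟨ cong (_+ ∣ H ─ K ∣) (trans (sym ∣K∣≡2) (sym (p⊆q⇒∣q∩p∣≡∣p∣ K⊆H))) ⟩
        ∣ H ∩ K ∣ + ∣ H ─ K ∣   ≡⟨ ∣p∣≡∣p∩q∣+∣p─q∣ H K ⟨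
        ∣ H ∣                   ≤⟨ ∣H∣≤4 ⟩
        4                       ∎)
        where open ≤-Reasoning

    commutative : ∀ x y → x ∙ y ≡ y ∙ x
    commutative = commuting-generators⇒commutative (proj₁ Y-irr) λ {x} {y} x∈Y y∈Y →
      case x Finₚ.≟ y of λ where
        (yes refl) → refl
        (no x≢y) → proj₂ (x∙x≡ε×x∙y≡y∙x x∈Y y∈Y x≢y)

    x∙x≡ε : ∀ x → x ∙ x ≡ ε
    x∙x≡ε = Commutative.squares-of-generators-trivial commutative (proj₁ Y-irr) λ {x} x∈Y →
      let (y , y∈Y-x) = 0<∣p∣⇒nonempty {p = Y - x}
                          (s≤s⁻¹ (≤-trans (s≤s (s≤s z≤n)) (≤-reflexive (trans (sym ∣Y∣≡3) (x∈p⇒∣p∣≡1+∣p-x∣ x∈Y)))))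
      in proj₁ (x∙x≡ε×x∙y≡y∙x x∈Y (p-x⊆p y∈Y-x) (x∈p-y⇒x≢y y∈Y-x ∘ sym))

    3≤∣generating∣ : ∀ {X} → Generates G X → 3 ≤ ∣ X ∣
    3≤∣generating∣ {X} X-gen with 3 ≤? ∣ X ∣
    ... | yes 3≤∣X∣ = 3≤∣X∣
    ... | no 3≰∣X∣ = contradiction (begin
      8              ≡⟨ generates⇒∣⟪X⟫∣≡n X-gen ⟨
      ∣ ⟪ X ⟫ ∣      ≤⟨ Commutative.Exponent2.∣⟪X⟫∣≤2^∣X∣ commutative x∙x≡ε X ⟩
      2 ℕ.^ ∣ X ∣    ≤⟨ ^-monoʳ-≤ 2 (s≤s⁻¹ (≰⇒> 3≰∣X∣)) ⟩
      4              ∎) (from-no (8 ≤? 4))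
      where open ≤-Reasoning

  even⊎square≡1-mod-8 : (k : Fin 8) → (∃[ j ] toℕ k ≡ 2 * j) ⊎ (toℕ k * toℕ k % 8 ≡ 1)
  even⊎square≡1-mod-8 zero = inj₁ (0 , refl)
  even⊎square≡1-mod-8 (suc zero) = inj₂ refl
  even⊎square≡1-mod-8 (suc (suc zero)) = inj₁ (1 , refl)
  even⊎square≡1-mod-8 (suc (suc (suc zero))) = inj₂ refl
  even⊎square≡1-mod-8 (suc (suc (suc (suc zero)))) = inj₁ (2 , refl)
  even⊎square≡1-mod-8 (suc (suc (suc (suc (suc zero))))) = inj₂ refl
  even⊎square≡1-mod-8 (suc (suc (suc (suc (suc (suc zero)))))) = inj₁ (3 , refl)
  even⊎square≡1-mod-8 (suc (suc (suc (suc (suc (suc (suc zero))))))) = inj₂ refl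

  module _ {g} (g-gen : Generates G ⁅ g ⁆) where

    private
      g^8≡ε : g ^ 8 ≡ ε
      g^8≡ε = generator⇒g^n≡ε g-gen

      E : Subset 8
      E = ⟪ ⁅ g ^ 2 ⁆ ⟫

      E≤G : IsSubgroup G E
      E≤G = ⟪⟫-isSubgroup ⁅ g ^ 2 ⁆

      g∉E : g ∉ E
      g∉E g∈E = contradiction (begin
        8             ≡⟨ generates⇒∣⟪X⟫∣≡n g-gen ⟨
        ∣ ⟪ ⁅ g ⁆ ⟫ ∣  ≤⟨ p⊆q⇒∣p∣≤∣q∣ (⟪⟫-least E≤G (λ x∈ → subst (_∈ E) (sym (x∈⁅y⁆⇒x≡y g x∈)) g∈E)) ⟩
        ∣ E ∣          ≤⟨ Powers.∣⟪x⟫∣≤m (g ^ 2) 4 (trans (sym (^-* g 2 4)) g^8≡ε) ⟩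
        4              ∎) (from-no (8 ≤? 4))
        where open ≤-Reasoning

      even-power∈E : ∀ j → g ^ (2 * j) ∈ E
      even-power∈E j = subst (_∈ E) (sym (^-* g 2 j)) (^-closed E≤G (X⊆⟪X⟫ (x∈⁅x⁆ (g ^ 2))) j)

      square≡1⇒generates : ∀ k → k * k % 8 ≡ 1 → Generates G ⁅ g ^ k ⁆
      square≡1⇒generates k k²%8≡1 = generates-⊆⟪⟫ ⁅g⁆⊆⟪g^k⟫ g-gen
        where
        g≡[g^k]^k : g ≡ (g ^ k) ^ k
        g≡[g^k]^k = begin
          g                 ≡⟨ identityʳ g ⟨
          g ^ 1             ≡⟨ cong (g ^_) k²%8≡1 ⟨
          g ^ (k * k % 8)   ≡⟨ Powers.x^k≡x^[k%m] g 8 g^8≡ε (k * k) ⟨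
          g ^ (k * k)       ≡⟨ ^-* g k k ⟩
          (g ^ k) ^ k       ∎
          where open ≡-Reasoning
        ⁅g⁆⊆⟪g^k⟫ : ⁅ g ⁆ ⊆ ⟪ ⁅ g ^ k ⁆ ⟫
        ⁅g⁆⊆⟪g^k⟫ x∈ = subst (_∈ ⟪ ⁅ g ^ k ⁆ ⟫) (sym (trans (x∈⁅y⁆⇒x≡y g x∈) g≡[g^k]^k))
                             (^-closed (⟪⟫-isSubgroup _) (X⊆⟪X⟫ (x∈⁅x⁆ (g ^ k))) k)

      ∉E⇒generates : ∀ {t} → t ∉ E → Generates G ⁅ t ⁆
      ∉E⇒generates {t} t∉E = by-parity (∈-image⁻ (Powers.power g 8 g^8≡ε) t∈powers)
        where
        t∈powers : t ∈ Powers.powers g 8 g^8≡ε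
        t∈powers = Powers.⟪x⟫⊆powers g 8 g^8≡ε (generates⇒∈⟪⟫ g-gen t)
        by-parity : (∃[ k ] k ∈ ⊤ × t ≡ g ^ toℕ k) → Generates G ⁅ t ⁆
        by-parity (k , _ , t≡g^k) = subst (λ x → Generates G ⁅ x ⁆) (sym t≡g^k)
          ([ (λ (j , k≡2j) → contradiction (subst (_∈ E) (trans (cong (g ^_) (sym k≡2j)) (sym t≡g^k))
                                                     (even-power∈E j)) t∉E)
           , square≡1⇒generates (toℕ k) ]′ (even⊎square≡1-mod-8 k))

    cyclic⇒∣irredundant∣≤1 : ∀ {T} → IrredundantGenSet G T → ∣ T ∣ ≤ 1
    cyclic⇒∣irredundant∣≤1 {T} (T-gen , T-min) = ≮⇒≥ λ 1<∣T∣ →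
      let (t , t∈T , t∉E) = p⊈q⇒∃∉ (λ T⊆E → g∉E (T-gen E E≤G T⊆E g))
          (b , b∈T-t) = 0<∣p∣⇒nonempty (s≤s⁻¹ (≤-trans 1<∣T∣ (≤-reflexive (x∈p⇒∣p∣≡1+∣p-x∣ t∈T))))
          ⁅t⁆⊆T-b : ⁅ t ⁆ ⊆ T - b
          ⁅t⁆⊆T-b = λ x∈ → subst (_∈ T - b) (sym (x∈⁅y⁆⇒x≡y t x∈)) (x∈p∧x≢y⇒x∈p-y t∈T (x∈p-y⇒x≢y b∈T-t ∘ sym))
      in T-min (T - b) (x∈p⇒p-x⊂p (p-x⊆p b∈T-t)) (generates-mono ⁅t⁆⊆T-b (∉E⇒generates t∉E))

  ∣irredundant∣≤∣generating∣ : ∀ {T X} → IrredundantGenSet G T → Generates G X → ∣ T ∣ ≤ ∣ X ∣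
  ∣irredundant∣≤∣generating∣ {T} {X} T-irr X-gen with ∣ T ∣ ≤? 2 | ∣ X ∣ ≤? 1
  ... | no ∣T∣≰2 | _ = ≤-trans (irredundant⇒∣Y∣≤3 T-irr)
                           (3≤∣generating∣ T-irr (≤-antisym (irredundant⇒∣Y∣≤3 T-irr) (≰⇒> ∣T∣≰2)) X-gen)
  ... | yes ∣T∣≤2 | no ∣X∣≰1 = ≤-trans ∣T∣≤2 (≰⇒> ∣X∣≰1)
  ... | yes _ | yes ∣X∣≤1 =
    let (x , x∈X) = generates⇒nonempty (s≤s (s≤s z≤n)) X-gen
    in ≤-trans (cyclic⇒∣irredundant∣≤1 (generates-mono (∣p∣≤1⇒p⊆⁅x⁆ ∣X∣≤1 x∈X) X-gen) T-irr) (x∈p⇒0<∣p∣ x∈X)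

module Quotient {n m} {G : FinGroup n} {N : Subset n} {Ḡ : FinGroup m} (G↠Ḡ : IsQuotientBy G N Ḡ) where

  open IsQuotientBy G↠Ḡ public using (π)
  open IsQuotientBy G↠Ḡ using (hom; surj; kernel)
  private
    module G = FinGroup G
    module Ḡ = FinGroup Ḡ
    module GT = FinGroupTheory G
    module ḠT = FinGroupTheory Ḡ

  π-ε : π G.ε ≡ Ḡ.ε
  π-ε = ḠT.identityˡ-unique (π G.ε) (π G.ε) (trans (sym (hom G.ε G.ε)) (cong π (GT.identityˡ G.ε)))

  π-⁻¹ : ∀ x → π (x G.⁻¹) ≡ (π x) Ḡ.⁻¹
  π-⁻¹ x = ḠT.inverseˡ-unique _ _ (trans (sym (hom (x G.⁻¹) x)) (trans (cong π (GT.inverseˡ x)) π-ε))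

  N-isSubgroup : IsSubgroup G N
  N-isSubgroup = ∈N π-ε
    , (λ x y x∈ y∈ → ∈N (trans (hom x y) (trans (cong₂ Ḡ._∙_ (N∋ x∈) (N∋ y∈)) (ḠT.identityˡ Ḡ.ε))))
    , (λ x x∈ → ∈N (trans (π-⁻¹ x) (trans (cong Ḡ._⁻¹ (N∋ x∈)) ḠT.ε⁻¹≈ε)))
    where
    ∈N : ∀ {x} → π x ≡ Ḡ.ε → x ∈ N
    ∈N = Equivalence.to (kernel _)
    N∋ : ∀ {x} → x ∈ N → π x ≡ Ḡ.ε
    N∋ = Equivalence.from (kernel _)

  image-isSubgroup : ∀ {H} → IsSubgroup G H → IsSubgroup Ḡ (image π H)
  image-isSubgroup {H} H≤G = subst (_∈ image π H) π-ε (∈-image⁺ π (GT.ε∈ H≤G))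
    , (λ _ _ x∈ y∈ → let (x , x∈H , ≡πx) = ∈-image⁻ π x∈ ; (y , y∈H , ≡πy) = ∈-image⁻ π y∈ in
        subst (_∈ image π H) (trans (hom x y) (sym (cong₂ Ḡ._∙_ ≡πx ≡πy))) (∈-image⁺ π (GT.∙-closed H≤G x∈H y∈H)))
    , (λ _ x∈ → let (x , x∈H , ≡πx) = ∈-image⁻ π x∈ in
        subst (_∈ image π H) (trans (π-⁻¹ x) (sym (cong Ḡ._⁻¹ ≡πx))) (∈-image⁺ π (GT.⁻¹-closed H≤G x∈H)))

  preimage : Subset m → Subset n
  preimage K = select (λ x → π x ∈? K)

  preimage-isSubgroup : ∀ {K} → IsSubgroup Ḡ K → IsSubgroup G (preimage K)
  preimage-isSubgroup {K} K≤Ḡ = ∈pre (subst (_∈ K) (sym π-ε) (ḠT.ε∈ K≤Ḡ))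
    , (λ x y x∈ y∈ → ∈pre (subst (_∈ K) (sym (hom x y)) (ḠT.∙-closed K≤Ḡ (pre∋ x∈) (pre∋ y∈))))
    , (λ x x∈ → ∈pre (subst (_∈ K) (sym (π-⁻¹ x)) (ḠT.⁻¹-closed K≤Ḡ (pre∋ x∈))))
    where
    ∈pre : ∀ {x} → π x ∈ K → x ∈ preimage K
    ∈pre = ∈-select⁺ (λ x → π x ∈? K)
    pre∋ : ∀ {x} → x ∈ preimage K → π x ∈ K
    pre∋ = ∈-select⁻ (λ x → π x ∈? K)

  image-generates : ∀ {S} → Generates G S → Generates Ḡ (image π S)
  image-generates {S} S-gen K K≤Ḡ πS⊆K y = subst (_∈ K) πx≡y (∈-select⁻ (λ x → π x ∈? K)
    (S-gen (preimage K) (preimage-isSubgroup K≤Ḡ) (∈-select⁺ (λ x → π x ∈? K) ∘ πS⊆K ∘ ∈-image⁺ π) x))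
    where
    x = proj₁ (surj y)
    πx≡y = proj₂ (surj y)

  ∣H∩N∣⊏∣H′∩N∣ : ∀ {R H H′ z} → Generates Ḡ (image π R) → IsSubgroup G H → IsSubgroup G H′ →
                 R ⊆ H → H ⊆ H′ → z ∈ H′ → z ∉ H → ∣ H ∩ N ∣ ⊏ ∣ H′ ∩ N ∣
  ∣H∩N∣⊏∣H′∩N∣ {R} {H} {H′} {z} πR-gen H≤G H′≤G R⊆H H⊆H′ z∈H′ z∉H =
    GT.⊂-subgroup⇒∣H∣⊏∣K∣ (GT.∩-isSubgroup H≤G N-isSubgroup) (GT.∩-isSubgroup H′≤G N-isSubgroup)
      ( (λ x∈ → let (x∈H , x∈N) = x∈p∩q⁻ H N x∈ in x∈p∩q⁺ (H⊆H′ x∈H , x∈N))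
      , w , x∈p∩q⁺ (w∈H′ , w∈N) , (λ w∈H∩N → w∉H (proj₁ (x∈p∩q⁻ H N w∈H∩N))))
    where
    lift-πz : ∃[ h ] h ∈ H × π z ≡ π h
    lift-πz = ∈-image⁻ π (πR-gen (image π H) (image-isSubgroup H≤G)
                (λ y∈ → let (r , r∈R , ≡πr) = ∈-image⁻ π y∈ in
                          subst (_∈ image π H) (sym ≡πr) (∈-image⁺ π (R⊆H r∈R)))
                (π z))
    h = proj₁ lift-πz
    h∈H = proj₁ (proj₂ lift-πz)
    w = (h G.⁻¹) G.∙ z
    w∈H′ : w ∈ H′
    w∈H′ = GT.∙-closed H′≤G (GT.⁻¹-closed H′≤G (H⊆H′ h∈H)) z∈H′
    w∈N : w ∈ N
    w∈N = Equivalence.to (kernel w) (begin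
      π ((h G.⁻¹) G.∙ z)          ≡⟨ hom (h G.⁻¹) z ⟩
      π (h G.⁻¹) Ḡ.∙ π z          ≡⟨ cong₂ Ḡ._∙_ (π-⁻¹ h) (proj₂ (proj₂ lift-πz)) ⟩
      (π h Ḡ.⁻¹) Ḡ.∙ π h          ≡⟨ ḠT.inverseˡ (π h) ⟩
      Ḡ.ε                         ∎)
      where open ≡-Reasoning
    w∉H : w ∉ H
    w∉H w∈H = z∉H (subst (_∈ H) (GT.\\-leftDividesˡ h z) (GT.∙-closed H≤G h∈H w∈H))

  module _ {S R} (S-irr : IrredundantGenSet G S) (πR-gen : Generates Ḡ (image π R)) where

    irredundant⇒∣⟪X-x⟫∩N∣⊏∣⟪X⟫∩N∣ : ∀ {X x} → X ⊆ S → R ⊆ X - x → x ∈ X →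
                                    ∣ GT.⟪ X - x ⟫ ∩ N ∣ ⊏ ∣ GT.⟪ X ⟫ ∩ N ∣
    irredundant⇒∣⟪X-x⟫∩N∣⊏∣⟪X⟫∩N∣ X⊆S R⊆X-x x∈X =
      ∣H∩N∣⊏∣H′∩N∣ πR-gen (GT.⟪⟫-isSubgroup _) (GT.⟪⟫-isSubgroup _) (GT.X⊆⟪X⟫ ∘ R⊆X-x) (GT.⟪⟫-mono p-x⊆p)
        (GT.X⊆⟪X⟫ x∈X) (GT.irredundant⇒∉⟪⟫ S-irr (X⊆S x∈X) (p⊆q⇒p-x⊆q-x X⊆S))

    ∣S∣≤∣R∣+2 : ∀ {p q} → Prime p → Prime q → ∣ N ∣ ≡ p * q → R ⊆ S → ∣ S ∣ ≤ ∣ R ∣ + 2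
    ∣S∣≤∣R∣+2 {p} {q} p-prime q-prime ∣N∣≡p*q R⊆S = ≮⇒≥ λ ∣R∣+2<∣S∣ →
      let (a , a∈S─R , 2≤) = pick 2 (3≤∣S─R∣ ∣R∣+2<∣S∣)
          (b , b∈S─R-a , 1≤) = pick 1 2≤
          (c , c∈S─R-a-b , _) = pick 0 1≤
      in no-three-outside-R (p─q⊆p S R a∈S─R) (p⊆q⇒p-x⊆q-x S─R⊆S b∈S─R-a)
           (p⊆q⇒p-x⊆q-x (p⊆q⇒p-x⊆q-x S─R⊆S) c∈S─R-a-b)
           (λ r∈R → x∈p∧x≢y⇒x∈p-y (x∈p∧x≢y⇒x∈p-y (x∈p∧x≢y⇒x∈p-y (R⊆S r∈R)
              (∉R r∈R a∈S─R)) (∉R r∈R (p-x⊆p b∈S─R-a))) (∉R r∈R (p-x⊆p (p-x⊆p c∈S─R-a-b))))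
      where
      S─R⊆S : S ─ R ⊆ S
      S─R⊆S = p─q⊆p S R
      ∉R : ∀ {r x} → r ∈ R → x ∈ S ─ R → r ≢ x
      ∉R r∈R x∈S─R refl = x∈p─q⇒x∉q x∈S─R r∈R
      3≤∣S─R∣ : ∣ R ∣ + 2 < ∣ S ∣ → 3 ≤ ∣ S ─ R ∣
      3≤∣S─R∣ ∣R∣+2<∣S∣ = +-cancelˡ-≤ (∣ R ∣) 3 (∣ S ─ R ∣) (begin
        ∣ R ∣ + 3               ≡⟨ +-suc ∣ R ∣ 2 ⟩
        suc (∣ R ∣ + 2)         ≤⟨ ∣R∣+2<∣S∣ ⟩
        ∣ S ∣                   ≡⟨ ∣p∣≡∣p∩q∣+∣p─q∣ S R ⟩
        ∣ S ∩ R ∣ + ∣ S ─ R ∣   ≤⟨ +-monoˡ-≤ ∣ S ─ R ∣ (∣p∩q∣≤∣q∣ S R) ⟩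
        ∣ R ∣ + ∣ S ─ R ∣       ∎)
        where open ≤-Reasoning
      no-three-outside-R : ∀ {a b c} → a ∈ S → b ∈ S - a → c ∈ S - a - b → ¬ R ⊆ S - a - b - c
      no-three-outside-R {a} {b} {c} a∈S b∈S-a c∈S-a-b R⊆S-a-b-c =
        no-⊏-chain-of-length-3-to-p*q p-prime q-prime
          (x∈p⇒0<∣p∣ (x∈p∩q⁺ (GT.ε∈ (GT.⟪⟫-isSubgroup _) , GT.ε∈ N-isSubgroup)))
          (irredundant⇒∣⟪X-x⟫∩N∣⊏∣⟪X⟫∩N∣ (p-x⊆p ∘ p-x⊆p) R⊆S-a-b-c c∈S-a-b)
          (irredundant⇒∣⟪X-x⟫∩N∣⊏∣⟪X⟫∩N∣ p-x⊆p (p-x⊆p ∘ R⊆S-a-b-c) b∈S-a)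
          (subst (∣ GT.⟪ S - a ⟫ ∩ N ∣ ⊏_) ∣⟪S⟫∩N∣≡p*q
            (irredundant⇒∣⟪X-x⟫∩N∣⊏∣⟪X⟫∩N∣ (λ x∈ → x∈) (p-x⊆p ∘ p-x⊆p ∘ R⊆S-a-b-c) a∈S))
        where
        ∣⟪S⟫∩N∣≡p*q : ∣ GT.⟪ S ⟫ ∩ N ∣ ≡ p * q
        ∣⟪S⟫∩N∣≡p*q = trans (p⊆q⇒∣q∩p∣≡∣p∣ (λ {x} _ → GT.generates⇒∈⟪⟫ (proj₁ S-irr) x)) ∣N∣≡p*q

lemma7p2 : (p q : ℕ) → Prime p → Prime q → p ≢ q
    → (G : FinGroup (8 * p * q))
    → (N : Subset (8 * p * q)) → IsNormalSubgroup G N → IsCyclicSubset G N → ∣ N ∣ ≡ p * q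
    → (Ḡ : FinGroup 8) → IsQuotientBy G N Ḡ
    → (S : Subset (8 * p * q)) → IrredundantGenSet G S
    → (T : Subset 8) → IrredundantGenSet Ḡ T
    → (∣ T ∣ ≤ ∣ S ∣) × (∣ S ∣ ≤ ∣ T ∣ + 2)
-- N is a subgroup as the kernel of π.
lemma7p2 p q p-prime q-prime _ G N _ _ ∣N∣≡p*q Ḡ G↠Ḡ S S-irr T T-irr = lower , upper
  where
  open Quotient G↠Ḡ
  open Order8 Ḡ using (∣irredundant∣≤∣generating∣)
  open FinGroupTheory Ḡ using (generates⇒∃irredundant⊆; generates-mono)
  πS-gen : Generates Ḡ (image π S)
  πS-gen = image-generates (proj₁ S-irr)
  lower : ∣ T ∣ ≤ ∣ S ∣
  lower = ≤-trans (∣irredundant∣≤∣generating∣ T-irr πS-gen) (∣image∣≤∣p∣ π S)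
  upper : ∣ S ∣ ≤ ∣ T ∣ + 2
  upper =
    let (Y , Y⊆πS , Y-irr) = generates⇒∃irredundant⊆ (image π S) πS-gen
        (R , R⊆S , ∣R∣≤∣Y∣ , Y⊆πR) = ⊆image⇒∃small-preimage π Y⊆πS
    in begin
      ∣ S ∣       ≤⟨ ∣S∣≤∣R∣+2 S-irr (generates-mono Y⊆πR (proj₁ Y-irr)) p-prime q-prime ∣N∣≡p*q R⊆S ⟩
      ∣ R ∣ + 2   ≤⟨ +-monoˡ-≤ 2 ∣R∣≤∣Y∣ ⟩
      ∣ Y ∣ + 2   ≤⟨ +-monoˡ-≤ 2 (∣irredundant∣≤∣generating∣ Y-irr (proj₁ T-irr)) ⟩
      ∣ T ∣ + 2   ∎
    where open ≤-Reasoning
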